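{- Let $p$ be a prime and let $a\geq 2$ be a natural number having at least one prime factor congruent to $1$ modulo $4$. Then the SP number $p a^2$ can be written as a sum of two SP numbers.
   Context: An SP number (square-prime number) is a natural number of the form $q\cdot b^2$ where $q$ is a prime and $b\geq 2$ is a natural number (i.e. $b\neq 1$). -}

module Defs where

open import Data.Nat using (ℕ; _*_; _^_; _≤_)
open import Data.Nat.Primality using (Prime)
open import Data.Product using (∃-syntax; _×_)
open import Relation.Binary.PropositionalEquality using (_≡_)

SP : ℕ → Set
SP n = ∃[ q ] ∃[ b ] (Prime q × 2 ≤ b × n ≡ q * b ^ 2)

-- Write a = c r with r ≡ 1 (mod 4) prime.  By Fermat, r = u² + v² with 0 < v < u, and Euclid's
-- parametrisation r² = (u² − v²)² + (2uv)² gives p a² = p (c (u² − v²))² + p (2cuv)².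
-- Fermat's theorem is Zagier's one-sentence proof: for r = 4k + 1 the finite set of positive
-- solutions of x² + 4yz = r carries Zagier's involution, whose only fixed point is (1, 1, k); so the
-- set has odd size, the involution (x, y, z) ↦ (x, z, y) has a fixed point, and r = x² + (2y)².
module Submission where

open import Data.List using (List; []; _∷_; length; filter; upTo; cartesianProduct)
open import Data.List.Membership.Propositional using (_∈_; _∉_; find)
open import Data.List.Membership.Propositional.Properties using (∈-filter⁺; ∈-filter⁻; ∈-upTo⁺; ∈-cartesianProduct⁺)
open import Data.List.Properties using (filter-accept; filter-reject; filter-all; length-filter)
open import Data.List.Relation.Unary.All as All using (All)
open import Data.List.Relation.Unary.Any using (Any; here; there)
open import Data.List.Relation.Unary.Any.Properties using (filter⁻)
open import Data.List.Relation.Unary.Unique.Propositional using (Unique; _∷_)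
import Data.List.Relation.Unary.Unique.Propositional.Properties as Unique
open import Data.Nat using (ℕ; zero; suc; _+_; _*_; _∸_; _^_; _%_; _/_; _≤_; _<_; _≤?_; _<?_; z≤n; s≤s; z<s; _≟_; >-nonZero)
open import Data.Nat.Divisibility using (_∣_; divides; _∣0; ∣1⇒≡1; ∣m∣n⇒∣m+n; ∣m+n∣m⇒∣n; ∣-refl; m∣m*n)
open import Data.Nat.DivMod using (m≡m%n+[m/n]*n)
open import Data.Nat.Induction using (<-wellFounded)
open import Data.Nat.Primality using (Prime; ¬prime[0]; ¬prime[1]; prime⇒irreducible)
open import Data.Nat.Properties
open import Data.Nat.Tactic.RingSolver using (solve-∀; solve)
open import Data.Product using (∃-syntax; _×_; _,_; proj₁; proj₂)
open import Data.Product.Properties using (≡-dec)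
open import Data.Sum using (_⊎_; inj₁; inj₂)
open import Function using (_∘_)
open import Induction.WellFounded using (Acc; acc)
open import Relation.Binary.Definitions using (DecidableEquality; tri<; tri≈; tri>)
open import Relation.Binary.PropositionalEquality
open import Relation.Nullary using (¬_; ¬?; yes; no; _×-dec_)
open import Relation.Nullary.Negation using (contradiction)
open import Relation.Unary using (Decidable)

open import Defs

2∣m⇒¬2∣1+m : ∀ {m} → 2 ∣ m → ¬ 2 ∣ suc m
2∣m⇒¬2∣1+m {m} 2∣m 2∣1+m with () ← ∣1⇒≡1 (∣m+n∣m⇒∣n (subst (2 ∣_) (+-comm 1 m) 2∣1+m) 2∣m)

module _ {A : Set} (_≟_ : DecidableEquality A) where

  _without_ : List A → A → List A
  xs without y = filter (¬? ∘ (_≟ y)) xs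

  ∈-without⁺ : ∀ {a y xs} → a ∈ xs → a ≢ y → a ∈ xs without y
  ∈-without⁺ = ∈-filter⁺ (¬? ∘ (_≟ _))

  ∈-without⁻ : ∀ {a y xs} → a ∈ xs without y → a ∈ xs × a ≢ y
  ∈-without⁻ = ∈-filter⁻ (¬? ∘ (_≟ _))

  length-without : ∀ {y xs} → Unique xs → y ∈ xs → length xs ≡ suc (length (xs without y))
  length-without {xs = x ∷ xs} (x∉xs ∷ _) (here refl) = cong (suc ∘ length) (sym (begin
    (x ∷ xs) without x ≡⟨ filter-reject (¬? ∘ (_≟ x)) (λ x≢x → x≢x refl) ⟩
    xs without x       ≡⟨ filter-all (¬? ∘ (_≟ x)) (All.map (λ x≢a a≡x → x≢a (sym a≡x)) x∉xs) ⟩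
    xs                 ∎))
    where open ≡-Reasoning
  length-without {y} {x ∷ xs} (x∉xs ∷ unique) (there y∈xs) = begin
    suc (length xs)                  ≡⟨ cong suc (length-without unique y∈xs) ⟩
    suc (suc (length (xs without y))) ≡⟨ cong (suc ∘ length) (sym (filter-accept (¬? ∘ (_≟ y)) (All.lookup x∉xs y∈xs))) ⟩
    suc (length ((x ∷ xs) without y)) ∎
    where open ≡-Reasoning

  record InvolutionOn (f : A → A) (xs : List A) : Set where
    field
      mapsTo     : ∀ {a} → a ∈ xs → f a ∈ xs
      involutive : ∀ {a} → a ∈ xs → f (f a) ≡ a

  module _ {f : A → A} where

    involutionOn-without : ∀ {xs c} → InvolutionOn f xs → f c ≡ c → InvolutionOn f (xs without c)
    involutionOn-without {c = c} inv fc≡c = record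
      { mapsTo     = λ a∈ → let a∈xs , a≢c = ∈-without⁻ a∈ in
                            ∈-without⁺ (mapsTo a∈xs) (λ fa≡c → a≢c (trans (sym (involutive a∈xs))
                                                                    (trans (cong f fa≡c) fc≡c)))
      ; involutive = involutive ∘ proj₁ ∘ ∈-without⁻
      }
      where open InvolutionOn inv

    involutionOn-∷-without : ∀ {x xs} → x ∉ xs → InvolutionOn f (x ∷ xs) → InvolutionOn f (xs without f x)
    involutionOn-∷-without {x} {xs} x∉xs inv = record
      { mapsTo     = λ a∈ → let a∈xs , a≢fx = ∈-without⁻ a∈ in mapsTo′ a∈xs a≢fx
      ; involutive = involutive ∘ there ∘ proj₁ ∘ ∈-without⁻
      }
      where
      open InvolutionOn inv
      mapsTo′ : ∀ {a} → a ∈ xs → a ≢ f x → f a ∈ xs without f x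
      mapsTo′ {a} a∈xs a≢fx with mapsTo (there a∈xs)
      ... | here fa≡x   = contradiction (trans (sym (involutive (there a∈xs))) (cong f fa≡x)) a≢fx
      ... | there fa∈xs = ∈-without⁺ fa∈xs λ fa≡fx →
        x∉xs (subst (_∈ xs) (trans (sym (involutive (there a∈xs)))
                              (trans (cong f fa≡fx) (involutive (here refl)))) a∈xs)

    fixedPoint⊎even : ∀ {xs} → Unique xs → InvolutionOn f xs → Any (λ a → f a ≡ a) xs ⊎ 2 ∣ length xs
    fixedPoint⊎even unique inv = go unique inv (<-wellFounded _)
      where
      go : ∀ {xs} → Unique xs → InvolutionOn f xs → Acc _<_ (length xs) →
           Any (λ a → f a ≡ a) xs ⊎ 2 ∣ length xs
      go {[]}     _                _   _         = inj₂ (2 ∣0)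
      go {x ∷ xs} x∷xs-unique@(_ ∷ unique) inv (acc rec) with f x ≟ x | InvolutionOn.mapsTo inv (here refl)
      ... | yes fx≡x | _             = inj₁ (here fx≡x)
      ... | no fx≢x  | here fx≡x     = contradiction fx≡x fx≢x
      ... | no _     | there fx∈xs
        with go (Unique.filter⁺ (¬? ∘ (_≟ f x)) unique) (involutionOn-∷-without (Unique.Unique[x∷xs]⇒x∉xs x∷xs-unique) inv)
                (rec (s≤s (length-filter (¬? ∘ (_≟ f x)) xs)))
      ... | inj₁ fixed = inj₁ (there (filter⁻ (¬? ∘ (_≟ f x)) fixed))
      ... | inj₂ even  = inj₂ (subst (2 ∣_) (sym (cong suc (length-without unique fx∈xs))) (∣m∣n⇒∣m+n ∣-refl even))

    uniqueFixedPoint⇒odd : ∀ {xs c} → Unique xs → InvolutionOn f xs → c ∈ xs → f c ≡ c →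
                           (∀ {a} → a ∈ xs → f a ≡ a → a ≡ c) → ¬ 2 ∣ length xs
    uniqueFixedPoint⇒odd {c = c} unique inv c∈xs fc≡c fixed⇒≡c 2∣|xs|
      with fixedPoint⊎even (Unique.filter⁺ (¬? ∘ (_≟ c)) unique) (involutionOn-without inv fc≡c)
    ... | inj₁ fixed = let a , a∈ , fa≡a = find fixed
                           a∈xs , a≢c = ∈-without⁻ a∈
                       in a≢c (fixed⇒≡c a∈xs fa≡a)
    ... | inj₂ even  = 2∣m⇒¬2∣1+m even (subst (2 ∣_) (length-without unique c∈xs) 2∣|xs|)

Triple : Set
Triple = ℕ × ℕ × ℕ

norm : Triple → ℕ
norm (x , y , z) = x * x + 4 * (y * z)

norm-diagonal : ∀ x z → x * x + 4 * (x * z) ≡ x * (x + 4 * z)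
norm-diagonal = solve-∀

zagier : Triple → Triple
zagier (x , y , z) with x + z <? y | x <? y + y
... | yes _ | _     = (z + z + x , z , y ∸ (x + z))
... | no _  | yes _ = ((y + y) ∸ x , y , (x + z) ∸ y)
... | no _  | no _  = (x ∸ (y + y) , x ∸ y + z , y)

-- The three cases of Zagier's map, with the defining inequalities turned into offsets so that no
-- truncated subtraction remains; the boundary x + z = y belongs to the middle region (e = 0).
data Region : Triple → Set where
  left   : ∀ x z e → Region (x , x + z + suc e , z)
  middle : ∀ {x y z} d e → y + e ≡ x + z → suc x + d ≡ y + y → Region (x , y , z)
  right  : ∀ x y z → Region (y + y + x , y , z)

region : ∀ t → Region t
region (x , y , z) with x + z <? y | x <? y + y
... | yes x+z<y | _ = let e , eq = m≤n⇒∃[o]m+o≡n x+z<y in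
  subst (λ y → Region (x , y , z)) (trans (+-suc (x + z) e) eq) (left x z e)
... | no x+z≮y | yes x<2y =
  let e , y+e≡x+z = m≤n⇒∃[o]m+o≡n (≮⇒≥ x+z≮y)
      d , 1+x+d≡2y = m≤n⇒∃[o]m+o≡n x<2y
  in middle d e y+e≡x+z 1+x+d≡2y
... | no _ | no x≮2y with x′ , refl ← m≤n⇒∃[o]m+o≡n (≮⇒≥ x≮2y) = right x′ y z

zagier-left : ∀ x z e → zagier (x , x + z + suc e , z) ≡ (z + z + x , z , suc e)
zagier-left x z e with x + z <? x + z + suc e
... | yes _     = cong (λ w → (z + z + x , z , w)) (m+n∸m≡n (x + z) (suc e))
... | no x+z≮y = contradiction (m<m+n (x + z) z<s) x+z≮y

zagier-middle : ∀ {x y z} d e → y + e ≡ x + z → suc x + d ≡ y + y → zagier (x , y , z) ≡ (suc d , y , e)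
zagier-middle {x} {y} {z} d e y+e≡x+z 1+x+d≡2y with x + z <? y | x <? y + y
... | yes x+z<y | _ = contradiction (subst (y ≤_) y+e≡x+z (m≤m+n y e)) (<⇒≱ x+z<y)
... | no _ | no x≮2y = contradiction (subst (suc x ≤_) 1+x+d≡2y (m≤m+n (suc x) d)) x≮2y
... | no _ | yes _ = cong₂ (λ u w → (u , y , w))
  (trans (cong (_∸ x) (trans (sym 1+x+d≡2y) (sym (+-suc x d)))) (m+n∸m≡n x (suc d)))
  (trans (cong (_∸ y) (sym y+e≡x+z)) (m+n∸m≡n y e))

zagier-right : ∀ x y z → zagier (y + y + x , y , z) ≡ (x , x + y + z , y)
zagier-right x y z with y + y + x + z <? y | y + y + x <? y + y
... | yes lt | _ = contradiction (≤-trans (m≤m+n y y) (≤-trans (m≤m+n (y + y) x) (m≤m+n _ z))) (<⇒≱ lt)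
... | no _ | yes lt = contradiction (m≤m+n (y + y) x) (<⇒≱ lt)
... | no _ | no _ = cong₂ (λ u w → (u , w + z , y)) (m+n∸m≡n (y + y) x)
  (trans (cong (_∸ y) (+-assoc y y x)) (trans (m+n∸m≡n y (y + x)) (+-comm y x)))

norm-middle : ∀ {x y z} d e → y + e ≡ x + z → suc x + d ≡ y + y → norm (suc d , y , e) ≡ norm (x , y , z)
norm-middle {x} {y} {z} d e y+e≡x+z 1+x+d≡2y = +-cancelʳ-≡ (4 * (x * y)) _ _ (begin
  suc d * suc d + 4 * (y * e) + 4 * (x * y)           ≡⟨ solve (x ∷ y ∷ d ∷ e ∷ []) ⟩
  suc d * suc d + 4 * (y * e) + (x + x) * (y + y)     ≡⟨ cong (λ s → suc d * suc d + 4 * (y * e) + (x + x) * s) (sym x+1+d≡2y) ⟩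
  suc d * suc d + 4 * (y * e) + (x + x) * (x + suc d) ≡⟨ solve (x ∷ y ∷ d ∷ e ∷ []) ⟩
  x * x + (x + suc d) * (x + suc d) + 4 * (y * e)     ≡⟨ cong (λ s → x * x + s * s + 4 * (y * e)) x+1+d≡2y ⟩
  x * x + (y + y) * (y + y) + 4 * (y * e)             ≡⟨ solve (x ∷ y ∷ e ∷ []) ⟩
  x * x + 4 * (y * (y + e))                           ≡⟨ cong (λ s → x * x + 4 * (y * s)) y+e≡x+z ⟩
  x * x + 4 * (y * (x + z))                           ≡⟨ solve (x ∷ y ∷ z ∷ []) ⟩
  x * x + 4 * (y * z) + 4 * (x * y)                   ∎)
  where
  open ≡-Reasoning
  x+1+d≡2y : x + suc d ≡ y + y
  x+1+d≡2y = trans (+-suc x d) 1+x+d≡2y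

zagier-norm : ∀ t → norm (zagier t) ≡ norm t
zagier-norm t with region t
... | left x z e = trans (cong norm (zagier-left x z e)) (identity x z e)
  where
  identity : ∀ x z e → (z + z + x) * (z + z + x) + 4 * (z * suc e) ≡ x * x + 4 * ((x + z + suc e) * z)
  identity = solve-∀
... | middle d e y+e≡x+z 1+x+d≡2y =
  trans (cong norm (zagier-middle d e y+e≡x+z 1+x+d≡2y)) (norm-middle d e y+e≡x+z 1+x+d≡2y)
... | right x y z = trans (cong norm (zagier-right x y z)) (identity x y z)
  where
  identity : ∀ x y z → x * x + 4 * ((x + y + z) * y) ≡ (y + y + x) * (y + y + x) + 4 * (y * z)
  identity = solve-∀

-- The image (1 + d, y, e) of a middle triple lies in the middle region again, with offsets z and x − 1.
middle-image : ∀ {x y z} d e → y + e ≡ x + z → x + suc d ≡ y + y → y + z ≡ suc d + e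
middle-image {x} {y} {z} d e y+e≡x+z x+1+d≡2y = +-cancelʳ-≡ x _ _ (begin
  y + z + x         ≡⟨ solve (x ∷ y ∷ z ∷ []) ⟩
  y + (x + z)       ≡⟨ cong (y +_) (sym y+e≡x+z) ⟩
  y + (y + e)       ≡⟨ sym (+-assoc y y e) ⟩
  y + y + e         ≡⟨ cong (_+ e) (sym x+1+d≡2y) ⟩
  x + suc d + e     ≡⟨ solve (x ∷ d ∷ e ∷ []) ⟩
  suc d + e + x     ∎)
  where open ≡-Reasoning

Positive : Triple → Set
Positive (x , y , z) = 1 ≤ x × 1 ≤ y × 1 ≤ z

zagier-involutive : ∀ {t} → Positive t → zagier (zagier t) ≡ t
zagier-involutive {x , y , z} (1≤x , _ , 1≤z) with region (x , y , z)
... | left x z e = trans (cong zagier (zagier-left x z e)) (zagier-right x z (suc e))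
... | right x y zero = contradiction 1≤z λ ()
... | right x y (suc e) = trans (cong zagier (zagier-right x y (suc e))) (zagier-left x y e)
... | middle {zero} d e _ _ = contradiction 1≤x λ ()
... | middle {suc x′} d e y+e≡x+z 1+x+d≡2y =
  trans (cong zagier (zagier-middle d e y+e≡x+z 1+x+d≡2y))
        (zagier-middle x′ _ (middle-image d e y+e≡x+z (trans (+-suc _ d) 1+x+d≡2y))
                            (trans (cong (suc ∘ suc) (+-comm d x′)) 1+x+d≡2y))

zagier-fixed : ∀ {x y z} → 1 ≤ z → zagier (x , y , z) ≡ (x , y , z) → x ≡ y
zagier-fixed {x} {y} {z} 1≤z fixed with region (x , y , z)
... | left x zero e = contradiction 1≤z λ ()
... | left x (suc z) e = contradiction (sym (cong proj₁ (trans (sym (zagier-left x (suc z) e)) fixed))) (m≢1+n+m x)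
... | right x y zero = contradiction 1≤z λ ()
... | right x y (suc z) = contradiction (subst (λ y → x ≡ y + y + x) y≡1+z x≡2y+x) (m≢1+n+m x)
  where
  same : (x , x + y + suc z , y) ≡ (y + y + x , y , suc z)
  same = trans (sym (zagier-right x y (suc z))) fixed
  x≡2y+x : x ≡ y + y + x
  x≡2y+x = cong proj₁ same
  y≡1+z : y ≡ suc z
  y≡1+z = cong (proj₂ ∘ proj₂) same
... | middle d e y+e≡x+z 1+x+d≡2y with trans (sym (zagier-middle d e y+e≡x+z 1+x+d≡2y)) fixed
...   | refl = sym (+-cancelʳ-≡ e _ _ y+e≡x+z)

4*m≢1+4*n : ∀ m n → 4 * m ≢ suc (4 * n)
4*m≢1+4*n m n eq with () ← ∣1⇒≡1 (∣m+n∣m⇒∣n (subst (4 ∣_) (trans eq (+-comm 1 (4 * n))) (m∣m*n m)) (m∣m*n n))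

prime[m*n]⇒m≡1⊎n≡1 : ∀ {m n} → Prime (m * n) → m ≡ 1 ⊎ n ≡ 1
prime[m*n]⇒m≡1⊎n≡1 {zero} p = contradiction p ¬prime[0]
prime[m*n]⇒m≡1⊎n≡1 {suc m} {n} p with prime⇒irreducible p (m∣m*n n)
... | inj₁ m≡1   = inj₁ m≡1
... | inj₂ m≡m*n = inj₂ (*-cancelˡ-≡ n 1 (suc m) (sym (trans (*-identityʳ (suc m)) m≡m*n)))

¬prime[n*n] : ∀ {n} → 2 ≤ n → ¬ Prime (n * n)
¬prime[n*n] {n} 2≤n p with prime[m*n]⇒m≡1⊎n≡1 {n} {n} p
... | inj₁ refl = contradiction 2≤n λ { (s≤s ()) }
... | inj₂ refl = contradiction 2≤n λ { (s≤s ()) }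

prime[1+4*k]⇒1≤k : ∀ {k} → Prime (suc (4 * k)) → 1 ≤ k
prime[1+4*k]⇒1≤k {zero}  p = contradiction p ¬prime[1]
prime[1+4*k]⇒1≤k {suc _} _ = s≤s z≤n

Windmill : ℕ → Triple → Set
Windmill n t = norm t ≡ n × Positive t

windmill? : ∀ n → Decidable (Windmill n)
windmill? n (x , y , z) = norm (x , y , z) ≟ n ×-dec 1 ≤? x ×-dec 1 ≤? y ×-dec 1 ≤? z

cube : ℕ → List Triple
cube n = cartesianProduct (upTo (suc n)) (cartesianProduct (upTo (suc n)) (upTo (suc n)))

windmills : ℕ → List Triple
windmills n = filter (windmill? n) (cube n)

windmills-unique : ∀ n → Unique (windmills n)
windmills-unique n = Unique.filter⁺ (windmill? n) {cube n}
  (Unique.cartesianProduct⁺ (Unique.upTo⁺ (suc n)) (Unique.cartesianProduct⁺ (Unique.upTo⁺ (suc n)) (Unique.upTo⁺ (suc n))))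

∈-windmills⁻ : ∀ {n t} → t ∈ windmills n → Windmill n t
∈-windmills⁻ {n} t∈ = proj₂ (∈-filter⁻ (windmill? n) {xs = cube n} t∈)

∈-windmills⁺ : ∀ {r t} → Windmill r t → t ∈ windmills r
∈-windmills⁺ {r} {x , y , z} w@(norm≡r , 1≤x , 1≤y , 1≤z) = ∈-filter⁺ (windmill? r) {xs = cube r}
  (∈-cartesianProduct⁺ (∈-upTo⁺ (s≤s x≤r)) (∈-cartesianProduct⁺ (∈-upTo⁺ (s≤s y≤r)) (∈-upTo⁺ (s≤s z≤r)))) w
  where
  open ≤-Reasoning
  yz≤r : y * z ≤ r
  yz≤r = begin
    y * z                    ≤⟨ m≤n*m (y * z) 4 ⟩
    4 * (y * z)              ≤⟨ m≤n+m _ (x * x) ⟩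
    norm (x , y , z)         ≡⟨ norm≡r ⟩
    r                        ∎
  x≤r : x ≤ r
  x≤r = begin
    x                        ≤⟨ m≤m*n x x {{>-nonZero 1≤x}} ⟩
    x * x                    ≤⟨ m≤m+n _ _ ⟩
    norm (x , y , z)         ≡⟨ norm≡r ⟩
    r                        ∎
  y≤r : y ≤ r
  y≤r = ≤-trans (m≤m*n y z {{>-nonZero 1≤z}}) yz≤r
  z≤r : z ≤ r
  z≤r = ≤-trans (m≤n*m z y {{>-nonZero 1≤y}}) yz≤r

swapYZ : Triple → Triple
swapYZ (x , y , z) = (x , z , y)

swapYZ-involutive : ∀ t → swapYZ (swapYZ t) ≡ t
swapYZ-involutive (x , y , z) = refl

windmill-swapYZ : ∀ {n t} → Windmill n t → Windmill n (swapYZ t)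
windmill-swapYZ {t = x , y , z} (norm≡n , 1≤x , 1≤y , 1≤z) =
  trans (cong (λ w → x * x + 4 * w) (*-comm z y)) norm≡n , 1≤x , 1≤z , 1≤y

SumOfTwoDistinctSquares : ℕ → Set
SumOfTwoDistinctSquares n = ∃[ u ] ∃[ v ] (1 ≤ v × v < u × n ≡ u * u + v * v)

_≟₃_ : DecidableEquality Triple
_≟₃_ = ≡-dec _≟_ (≡-dec _≟_ _≟_)

module _ {k : ℕ} (r-prime : Prime (suc (4 * k))) where

  private
    r : ℕ
    r = suc (4 * k)

  zagier-positive : ∀ {t} → Windmill r t → Positive (zagier t)
  zagier-positive {t} w with region t
  ... | left x z e = let _ , 1≤x , _ , 1≤z = w in
    subst Positive (sym (zagier-left x z e)) (≤-trans 1≤x (m≤n+m x (z + z)) , 1≤z , s≤s z≤n)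
  ... | right zero y z = contradiction (trans (sym (identity y z)) (proj₁ w)) (4*m≢1+4*n (y * y + y * z) k)
    where
    identity : ∀ y z → (y + y + 0) * (y + y + 0) + 4 * (y * z) ≡ 4 * (y * y + y * z)
    identity = solve-∀
  ... | right (suc x) y z = let _ , _ , 1≤y , _ = w in
    subst Positive (sym (zagier-right (suc x) y z)) (s≤s z≤n , s≤s z≤n , 1≤y)
  ... | middle {x} {y} {z} d zero y+0≡x+z _ = let norm≡r , 1≤x , _ , 1≤z = w in
    contradiction (subst Prime (square norm≡r y+0≡x+z) r-prime)
                  (¬prime[n*n] (≤-trans (+-mono-≤ 1≤x 1≤z) (m≤m+n (x + z) z)))
    where
    square : norm (x , y , z) ≡ r → y + 0 ≡ x + z → r ≡ (x + z + z) * (x + z + z)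
    square norm≡r y+0≡x+z = begin
      r                        ≡⟨ sym norm≡r ⟩
      x * x + 4 * (y * z)      ≡⟨ cong (λ y → x * x + 4 * (y * z)) (trans (sym (+-identityʳ y)) y+0≡x+z) ⟩
      x * x + 4 * ((x + z) * z) ≡⟨ solve (x ∷ z ∷ []) ⟩
      (x + z + z) * (x + z + z) ∎
      where open ≡-Reasoning
  ... | middle {y = y} d (suc e) y+e≡x+z 1+x+d≡2y = let _ , _ , 1≤y , _ = w in
    subst Positive (sym (zagier-middle d (suc e) y+e≡x+z 1+x+d≡2y)) (s≤s z≤n , 1≤y , s≤s z≤n)

  windmill-zagier : ∀ {t} → Windmill r t → Windmill r (zagier t)
  windmill-zagier {t} w = trans (zagier-norm t) (proj₁ w) , zagier-positive w

  windmill-zagier-fixed : ∀ {t} → Windmill r t → zagier t ≡ t → t ≡ (1 , 1 , k)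
  windmill-zagier-fixed {x , y , z} (norm≡r , 1≤x , _ , 1≤z) fixed with refl ← zagier-fixed 1≤z fixed
    with prime[m*n]⇒m≡1⊎n≡1 {x} {x + 4 * z} (subst Prime (trans (sym norm≡r) (norm-diagonal x z)) r-prime)
  ... | inj₂ x+4z≡1 = contradiction (sym x+4z≡1) (<⇒≢ (+-mono-≤ 1≤x (≤-trans 1≤z (m≤n*m z 4))))
  ... | inj₁ refl = cong (λ z → (1 , 1 , z)) (*-cancelˡ-≡ z k 4 (trans (cong (4 *_) (sym (*-identityˡ z))) (suc-injective norm≡r)))

  zagier-involution : InvolutionOn _≟₃_ zagier (windmills r)
  zagier-involution = record
    { mapsTo     = ∈-windmills⁺ {r} ∘ windmill-zagier ∘ ∈-windmills⁻ {r}
    ; involutive = zagier-involutive ∘ proj₂ ∘ ∈-windmills⁻ {r}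
    }

  swapYZ-involution : InvolutionOn _≟₃_ swapYZ (windmills r)
  swapYZ-involution = record
    { mapsTo     = ∈-windmills⁺ {r} ∘ windmill-swapYZ ∘ ∈-windmills⁻ {r}
    ; involutive = λ {t} _ → swapYZ-involutive t
    }

  windmills-odd : ¬ 2 ∣ length (windmills r)
  windmills-odd = uniqueFixedPoint⇒odd _≟₃_ (windmills-unique r) zagier-involution
    (∈-windmills⁺ ((cong (suc ∘ (4 *_)) (*-identityˡ k)) , s≤s z≤n , s≤s z≤n , prime[1+4*k]⇒1≤k r-prime))
    (zagier-middle 0 k refl refl)  -- (1 , 1 , k) lies in the middle region, with d = 0 and e = k
    (λ t∈ → windmill-zagier-fixed (∈-windmills⁻ t∈))

  windmill-diagonal⇒sumOfTwoSquares : ∀ {x y} → Windmill r (x , y , y) → SumOfTwoDistinctSquares r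
  windmill-diagonal⇒sumOfTwoSquares {x} {y} (norm≡r , 1≤x , 1≤y , _) with <-cmp x (y + y)
  ... | tri< x<2y _ _ = y + y , x , 1≤x , x<2y , (begin
    r                         ≡⟨ sym norm≡r ⟩
    x * x + 4 * (y * y)       ≡⟨ solve (x ∷ y ∷ []) ⟩
    (y + y) * (y + y) + x * x ∎)
    where open ≡-Reasoning
  ... | tri≈ _ refl _ = contradiction (begin
    4 * (y * y + y * y)                     ≡⟨ solve (y ∷ []) ⟩
    (y + y) * (y + y) + 4 * (y * y)         ≡⟨ norm≡r ⟩
    r                                       ∎) (4*m≢1+4*n (y * y + y * y) k)
    where open ≡-Reasoning
  ... | tri> _ _ 2y<x = x , y + y , ≤-trans 1≤y (m≤m+n y y) , 2y<x , (begin
    r                         ≡⟨ sym norm≡r ⟩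
    x * x + 4 * (y * y)       ≡⟨ solve (x ∷ y ∷ []) ⟩
    x * x + (y + y) * (y + y) ∎)
    where open ≡-Reasoning

  prime[1+4k]⇒sumOfTwoSquares : SumOfTwoDistinctSquares (suc (4 * k))
  prime[1+4k]⇒sumOfTwoSquares with fixedPoint⊎even _≟₃_ (windmills-unique r) swapYZ-involution
  ... | inj₂ even  = contradiction even windmills-odd
  ... | inj₁ fixed with (x , y , .y) , t∈ , refl ← find fixed =
    windmill-diagonal⇒sumOfTwoSquares (∈-windmills⁻ t∈)

prime≡1[mod4]⇒sumOfTwoSquares : ∀ {r} → Prime r → r % 4 ≡ 1 → SumOfTwoDistinctSquares r
prime≡1[mod4]⇒sumOfTwoSquares {r} r-prime r%4≡1 =
  subst SumOfTwoDistinctSquares (sym r≡1+4k) (prime[1+4k]⇒sumOfTwoSquares {r / 4} (subst Prime r≡1+4k r-prime))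
  where
  r≡1+4k : r ≡ suc (4 * (r / 4))
  r≡1+4k = trans (m≡m%n+[m/n]*n r 4) (cong₂ _+_ r%4≡1 (*-comm (r / 4) 4))

euclid-triple : ∀ v d → let u = suc v + d in
  (u * u + v * v) * (u * u + v * v) ≡ (suc d * (u + v)) * (suc d * (u + v)) + (2 * (u * v)) * (2 * (u * v))
euclid-triple = solve-∀

n^2≡n*n : ∀ n → n ^ 2 ≡ n * n
n^2≡n*n n = cong (n *_) (*-identityʳ n)

scale-pythagorean : ∀ p c {x a b} → x * x ≡ a * a + b * b → p * (c * x) ^ 2 ≡ p * (c * a) ^ 2 + p * (c * b) ^ 2
scale-pythagorean p c {x} {a} {b} x²≡a²+b² = begin
  p * (c * x) ^ 2                                   ≡⟨ cong (p *_) (n^2≡n*n (c * x)) ⟩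
  p * ((c * x) * (c * x))                           ≡⟨ solve (p ∷ c ∷ x ∷ []) ⟩
  p * (c * c) * (x * x)                             ≡⟨ cong (p * (c * c) *_) x²≡a²+b² ⟩
  p * (c * c) * (a * a + b * b)                     ≡⟨ solve (p ∷ c ∷ a ∷ b ∷ []) ⟩
  p * ((c * a) * (c * a)) + p * ((c * b) * (c * b)) ≡⟨ sym (cong₂ _+_ (cong (p *_) (n^2≡n*n (c * a)))
                                                                         (cong (p *_) (n^2≡n*n (c * b)))) ⟩
  p * (c * a) ^ 2 + p * (c * b) ^ 2                 ∎
  where open ≡-Reasoning

prime*[sumOfTwoSquares]²≡SP+SP : ∀ {p c u v} → Prime p → 1 ≤ c → 1 ≤ v → v < u →
  ∃[ m ] ∃[ n ] (SP m × SP n × p * (c * (u * u + v * v)) ^ 2 ≡ m + n)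
prime*[sumOfTwoSquares]²≡SP+SP {p} {c} {u} {v} p-prime 1≤c 1≤v v<u with d , refl ← m≤n⇒∃[o]m+o≡n v<u =
  p * (c * a) ^ 2 , p * (c * b) ^ 2 , (p , c * a , p-prime , 2≤ca , refl) , (p , c * b , p-prime , 2≤cb , refl) ,
  scale-pythagorean p c (euclid-triple v d)
  where
  a b : ℕ
  a = suc d * (u + v)
  b = 2 * (u * v)
  2≤ca : 2 ≤ c * a
  2≤ca = *-mono-≤ 1≤c (*-mono-≤ (s≤s (z≤n {d})) (s≤s (≤-trans 1≤v (≤-trans (m≤m+n v d) (m≤m+n (v + d) v)))))
  2≤cb : 2 ≤ c * b
  2≤cb = *-mono-≤ 1≤c (*-mono-≤ (≤-refl {2}) (*-mono-≤ (s≤s (z≤n {v + d})) 1≤v))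

theorem2p4 : (p a : ℕ) → Prime p → 2 ≤ a →
    (∃[ r ] (Prime r × r ∣ a × r % 4 ≡ 1)) →
    ∃[ m ] ∃[ n ] (SP m × SP n × p * a ^ 2 ≡ m + n)
theorem2p4 p a p-prime 2≤a (r , r-prime , divides zero a≡0 , r%4≡1) = contradiction (subst (2 ≤_) a≡0 2≤a) λ ()
theorem2p4 p a p-prime 2≤a (r , r-prime , divides c@(suc c′) a≡c*r , r%4≡1)
  with u , v , 1≤v , v<u , r≡u²+v² ← prime≡1[mod4]⇒sumOfTwoSquares r-prime r%4≡1
  with m , n , m-SP , n-SP , split ← prime*[sumOfTwoSquares]²≡SP+SP p-prime (s≤s (z≤n {c′})) 1≤v v<u =
  m , n , m-SP , n-SP , trans (cong (λ b → p * b ^ 2) (trans a≡c*r (cong (c *_) r≡u²+v²))) split
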